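{- For all $n\ge5$, $|\Pi_n(1/24/3)|<|\Pi_n(1/2/3/4)|$.
   Context: The standardization of a set partition of a finite set $S\subset\mathbb{Z}_{>0}$ replaces the $i$-th smallest element of $S$ by $i$. A set partition $\pi$ of $[n]$ contains $\tau\vdash[k]$ if for some $S\subseteq[n]$ the standardization of the restriction of $\pi$ to $S$ is $\tau$; otherwise it avoids $\tau$. $\Pi_n(\tau)$ is the set of partitions of $[n]$ avoiding $\tau$. $1/24/3$ is the partition of $[4]$ with blocks $\{1\},\{2,4\},\{3\}$, and $1/2/3/4$ is the partition of $[4]$ into four singletons. -}

module Defs where

open import Data.Bool using (Bool; true; false; _∧_; _∨_; not; if_then_else_)
open import Data.Nat using (ℕ; zero; suc; _≡ᵇ_; _≤ᵇ_; _⊔_)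
open import Data.List using (List; []; _∷_; length; map; _++_; filterᵇ; concatMap; upTo)
open import Data.Bool.ListAction using (any)

-- A set partition of [n] = {1,…,n} is encoded by its canonical block-labelling
-- word (restricted growth string) w = w₁ … wₙ : wᵢ is the index (0-based) of
-- the block containing i, blocks being numbered in order of their least
-- elements.  Thus i, j lie in the same block iff wᵢ = wⱼ, and the encoding is
-- a bijection between set partitions of [n] and restricted growth strings.

isRGS-from : ℕ → List ℕ → Bool
isRGS-from m []       = true
isRGS-from m (x ∷ xs) = (x ≤ᵇ m) ∧ isRGS-from (m ⊔ suc x) xs

isRGS : List ℕ → Bool
isRGS = isRGS-from 0

words : ℕ → ℕ → List (List ℕ)
words zero    b = [] ∷ []
words (suc k) b = concatMap (λ x → map (x ∷_) (words k b)) (upTo b)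

-- the set partitions of [n] (as restricted growth strings); every RGS of
-- length n has letters < n, so filtering words n n gives all of them
SetPartitions : ℕ → List (List ℕ)
SetPartitions n = filterᵇ isRGS (words n n)

-- restrictions to subsets S ⊆ [n] with |S| = k : the order-preserving
-- subwords of length k (subword at positions s₁ < … < sₖ of S)
subwords : ℕ → List ℕ → List (List ℕ)
subwords zero    xs       = [] ∷ []
subwords (suc k) []       = []
subwords (suc k) (x ∷ xs) = map (x ∷_) (subwords k xs) ++ subwords (suc k) xs

-- standardization: relabel the blocks of a labelled word in order of first
-- occurrence (i.e. of least elements), giving the canonical RGS of the
-- standardized restricted partition
index-of : ℕ → List ℕ → ℕ → ℕ
index-of x []       i = i
index-of x (y ∷ ys) i = if x ≡ᵇ y then i else index-of x ys (suc i)

elemᵇ : ℕ → List ℕ → Bool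
elemᵇ x = any (x ≡ᵇ_)

standardize-go : List ℕ → List ℕ → List ℕ
standardize-go seen []       = []
standardize-go seen (x ∷ xs) with elemᵇ x seen
... | true  = index-of x seen 0 ∷ standardize-go seen xs
... | false = length seen ∷ standardize-go (seen ++ (x ∷ [])) xs

standardize : List ℕ → List ℕ
standardize = standardize-go []

eqListᵇ : List ℕ → List ℕ → Bool
eqListᵇ []       []       = true
eqListᵇ (x ∷ xs) (y ∷ ys) = (x ≡ᵇ y) ∧ eqListᵇ xs ys
eqListᵇ _        _        = false

contains : List ℕ → List ℕ → Bool
contains π τ = any (λ u → eqListᵇ (standardize u) τ) (subwords (length τ) π)

avoids : List ℕ → List ℕ → Bool
avoids π τ = not (contains π τ)

Avoiders : ℕ → List ℕ → List (List ℕ)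
Avoiders n τ = filterᵇ (λ π → avoids π τ) (SetPartitions n)

numAvoiders : ℕ → List ℕ → ℕ
numAvoiders n τ = length (Avoiders n τ)

τ-1/24/3 : List ℕ
τ-1/24/3 = 0 ∷ 1 ∷ 2 ∷ 1 ∷ []

τ-1/2/3/4 : List ℕ
τ-1/2/3/4 = 0 ∷ 1 ∷ 2 ∷ 3 ∷ []

-- In an RGS avoiding 1/24/3,
-- after the leading zeros each letter is the current maximum c or a new
-- maximum, since a letter 0 < y < c would complete 0 y c y; a 0 returning after
-- a positive letter leaves only 0, c and new maxima, and once a new maximum
-- follows such a return, 0 is excluded, since u 0 z 0 is again a copy of
-- 1/24/3.  So these strings are read along the graph Stage, whose vertices have
-- at most three outgoing edges, and they are at most as many as its paths.
-- Every RGS with at most three blocks avoids 1/2/3/4, and their automaton has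
-- three edges at every vertex with three blocks.  Sending each stage to such a
-- vertex bounds the paths by these strings; the two-edge stage 'sealed' makes
-- the bound strict, and the gap reaches the initial vertex at length 5.

module Submission where

open import Defs
open import Data.Bool using (Bool; true; false; T; not; _∧_; if_then_else_)
open import Data.Bool.Properties using (T-∧; T-≡)
open import Data.List using (List; []; _∷_; [_]; length; map; _++_; filterᵇ; concatMap; upTo)
open import Data.List.Properties
  using (filter-++; length-++; map-cong; upTo-∷ʳ; filter-none; ++-assoc)
open import Data.List.Membership.Propositional using (_∈_; find; lose)
open import Data.List.Membership.Propositional.Properties
  using (∈-++⁺ˡ; ∈-++⁺ʳ; ∈-++⁻; ∈-map⁺; ∈-map⁻; ∈-concatMap⁺; ∈-upTo⁺; ∈-upTo⁻)
open import Data.List.Relation.Unary.All as All using (All; []; _∷_)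
open import Data.List.Relation.Unary.Any using (here; there)
open import Data.List.Relation.Unary.Any.Properties using (any⁺; any⁻)
open import Data.List.Relation.Unary.AllPairs using ([]; _∷_)
open import Data.List.Relation.Unary.Unique.Propositional using (Unique)
open import Data.List.Relation.Unary.Unique.Propositional.Properties using (upTo⁺)
open import Data.List.Relation.Binary.Sublist.Propositional
  using (_⊆_; []; _∷_; _∷ʳ_; minimum; ⊆-refl; ⊆-trans)
open import Data.List.Relation.Binary.Sublist.Propositional.Properties
  using (map⁺; ++⁺; ++⁺ˡ; ++⁺ʳ; filter⁺; length-mono-≤; All-resp-⊆)
open import Data.Maybe using (Maybe; just; nothing; maybe)
open import Data.Nat using (ℕ; zero; suc; _+_; _≤_; _<_; z≤n; s≤s; s≤s⁻¹; _≡ᵇ_; _<ᵇ_; _⊔_; _≟_)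
open import Data.Nat.ListAction using (sum)
open import Data.Nat.Properties
open import Algebra.Properties.CommutativeSemigroup +-commutativeSemigroup using (x∙yz≈y∙xz)
open import Data.Product using (∃; ∃₂; _×_; _,_; proj₁; proj₂)
open import Data.Sum using (_⊎_; inj₁; inj₂)
open import Data.Unit using (⊤; tt)
open import Function using (_∘_; Equivalence)
open import Relation.Binary.PropositionalEquality
  using (_≡_; _≢_; ≢-sym; refl; sym; cong; subst; module ≡-Reasoning)
open import Relation.Nullary using (¬_; ¬?; yes; no)
open import Relation.Nullary.Decidable using (T?; from-yes; dec-true; dec-false)
open import Relation.Nullary.Negation using (contradiction)

private variable
  A B : Set

length-filterᵇ-mono : {p q : A → Bool} → (∀ x → T (p x) → T (q x)) → ∀ xs →
                      length (filterᵇ p xs) ≤ length (filterᵇ q xs)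
length-filterᵇ-mono {p = p} {q} p⇒q xs =
  length-mono-≤ (filter⁺ (T? ∘ p) (T? ∘ q) (λ { refl → p⇒q _ }) (⊆-refl {x = xs}))

filterᵇ-filterᵇ : (p q : A → Bool) → ∀ xs → filterᵇ p (filterᵇ q xs) ≡ filterᵇ (λ x → q x ∧ p x) xs
filterᵇ-filterᵇ p q []       = refl
filterᵇ-filterᵇ p q (x ∷ xs) with q x
... | false = filterᵇ-filterᵇ p q xs
... | true with p x
...   | true  = cong (x ∷_) (filterᵇ-filterᵇ p q xs)
...   | false = filterᵇ-filterᵇ p q xs

length-filterᵇ-map : (p : B → Bool) (f : A → B) → ∀ xs →
                     length (filterᵇ p (map f xs)) ≡ length (filterᵇ (p ∘ f) xs)
length-filterᵇ-map p f []       = refl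
length-filterᵇ-map p f (x ∷ xs) with p (f x)
... | true  = cong suc (length-filterᵇ-map p f xs)
... | false = length-filterᵇ-map p f xs

length-filterᵇ-concatMap : (p : B → Bool) (f : A → List B) → ∀ xs →
  length (filterᵇ p (concatMap f xs)) ≡ sum (map (λ x → length (filterᵇ p (f x))) xs)
length-filterᵇ-concatMap p f []       = refl
length-filterᵇ-concatMap p f (x ∷ xs) = begin
  length (filterᵇ p (f x ++ concatMap f xs))
    ≡⟨ cong length (filter-++ (T? ∘ p) (f x) (concatMap f xs)) ⟩
  length (filterᵇ p (f x) ++ filterᵇ p (concatMap f xs))
    ≡⟨ length-++ (filterᵇ p (f x)) ⟩
  length (filterᵇ p (f x)) + length (filterᵇ p (concatMap f xs))
    ≡⟨ cong (length (filterᵇ p (f x)) +_) (length-filterᵇ-concatMap p f xs) ⟩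
  length (filterᵇ p (f x)) + sum (map (λ x → length (filterᵇ p (f x))) xs) ∎
  where open ≡-Reasoning

length-filterᵇ-false : (xs : List A) → length (filterᵇ (λ _ → false) xs) ≡ 0
length-filterᵇ-false xs = cong length (filter-none (T? ∘ λ _ → false) (All.universal (λ _ ()) xs))

sum-map-mono : {f g : A → ℕ} → (∀ x → f x ≤ g x) → ∀ xs → sum (map f xs) ≤ sum (map g xs)
sum-map-mono f≤g []       = z≤n
sum-map-mono f≤g (x ∷ xs) = +-mono-≤ (f≤g x) (sum-map-mono f≤g xs)

sum-mono-⊆ : {ms ns : List ℕ} → ms ⊆ ns → sum ms ≤ sum ns
sum-mono-⊆ []         = z≤n
sum-mono-⊆ (n ∷ʳ p)   = ≤-trans (sum-mono-⊆ p) (m≤n+m _ n)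
sum-mono-⊆ (refl ∷ p) = +-monoʳ-≤ _ (sum-mono-⊆ p)

upTo-mono : ∀ {m n} → m ≤ n → upTo m ⊆ upTo n
upTo-mono {n = zero}  z≤n = []
upTo-mono {m} {suc n} m≤1+n with m≤n⇒m<n∨m≡n m≤1+n
... | inj₂ refl      = ⊆-refl
... | inj₁ (s≤s m≤n) = subst (upTo m ⊆_) (upTo-∷ʳ n) (++⁺ʳ [ n ] (upTo-mono m≤n))

≡ᵇ-refl : ∀ n → (n ≡ᵇ n) ≡ true
≡ᵇ-refl n = dec-true (n ≟ n) refl

≢⇒≡ᵇ-false : ∀ {m n} → m ≢ n → (m ≡ᵇ n) ≡ false
≢⇒≡ᵇ-false {m} {n} = dec-false (m ≟ n)

T-not⇒¬T : ∀ {b} → T (not b) → ¬ T b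
T-not⇒¬T {true} ()

¬T⇒T-not : ∀ {b} → ¬ T b → T (not b)
¬T⇒T-not {true}  ¬t = ¬t _
¬T⇒T-not {false} _  = _

-- Automata over ℕ

module Automaton {S : Set} (edges : S → List (ℕ × S)) where

  transition : List (ℕ × S) → ℕ → Maybe S
  transition []             x = nothing
  transition ((a , t) ∷ es) x with x ≟ a
  ... | yes _ = just t
  ... | no  _ = transition es x

  next : S → ℕ → Maybe S
  next s = transition (edges s)

  accepts : S → List ℕ → Bool
  accepts s []       = true
  accepts s (x ∷ xs) = maybe (λ t → accepts t xs) false (next s x)

  count : ℕ → ℕ → S → ℕ
  count b k s = length (filterᵇ (accepts s) (words k b))

  paths : ℕ → S → ℕ
  paths zero    s = 1
  paths (suc k) s = sum (map (paths k ∘ proj₂) (edges s))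

  transition-just : ∀ es {x t} → transition es x ≡ just t → (x , t) ∈ es
  transition-just ((a , t) ∷ es) {x} eq with x ≟ a
  transition-just ((a , t) ∷ es) refl | yes refl = here refl
  ... | no _ = there (transition-just es eq)

  transition-nothing : ∀ es {x} → transition es x ≡ nothing → All ((x ≢_) ∘ proj₁) es
  transition-nothing []             eq = []
  transition-nothing ((a , t) ∷ es) {x} eq with x ≟ a
  ... | no x≢a = x≢a ∷ transition-nothing es eq

  count-suc : ∀ b k s →
              count b (suc k) s ≡ sum (map (λ x → maybe (count b k) 0 (next s x)) (upTo b))
  count-suc b k s = begin
    length (filterᵇ (accepts s) (concatMap (λ x → map (x ∷_) (words k b)) (upTo b)))
      ≡⟨ length-filterᵇ-concatMap (accepts s) _ (upTo b) ⟩
    sum (map (λ x → length (filterᵇ (accepts s) (map (x ∷_) (words k b)))) (upTo b))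
      ≡⟨ cong sum (map-cong (λ x → length-filterᵇ-map (accepts s) (x ∷_) (words k b)) (upTo b)) ⟩
    sum (map (λ x → length (filterᵇ (λ w → accepts s (x ∷ w)) (words k b))) (upTo b))
      ≡⟨ cong sum (map-cong (λ x → count-step (next s x)) (upTo b)) ⟩
    sum (map (λ x → maybe (count b k) 0 (next s x)) (upTo b)) ∎
    where
    open ≡-Reasoning
    count-step : ∀ r → length (filterᵇ (λ w → maybe (λ t → accepts t w) false r) (words k b))
                       ≡ maybe (count b k) 0 r
    count-step (just t) = refl
    count-step nothing  = length-filterᵇ-false (words k b)

  module _ (g : S → ℕ) where

    weight : List (ℕ × S) → ℕ → ℕ
    weight es x = maybe g 0 (transition es x)

    sum-weight-[] : ∀ xs → sum (map (weight []) xs) ≡ 0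
    sum-weight-[] []       = refl
    sum-weight-[] (x ∷ xs) = sum-weight-[] xs

    sum-weight-skip : ∀ {a t es xs} → All (a ≢_) xs →
                      sum (map (weight ((a , t) ∷ es)) xs) ≡ sum (map (weight es) xs)
    sum-weight-skip []                                 = refl
    sum-weight-skip {a} {t} {es} {x ∷ _} (a≢x ∷ a∉xs) with x ≟ a
    ... | yes refl = contradiction refl a≢x
    ... | no _     = cong (weight es x +_) (sum-weight-skip a∉xs)

    sum-weight-∷ : ∀ {a t es xs} → Unique xs →
                   sum (map (weight ((a , t) ∷ es)) xs) ≤ g t + sum (map (weight es) xs)
    sum-weight-∷ []                                    = z≤n
    sum-weight-∷ {a} {t} {es} {x ∷ xs} (x∉xs ∷ unique) with x ≟ a
    ... | yes refl = +-monoʳ-≤ (g t) (≤-trans (≤-reflexive (sum-weight-skip x∉xs)) (m≤n+m _ _))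
    ... | no _     = begin
      weight es x + sum (map (weight ((a , t) ∷ es)) xs) ≤⟨ +-monoʳ-≤ _ (sum-weight-∷ unique) ⟩
      weight es x + (g t + sum (map (weight es) xs))      ≡⟨ x∙yz≈y∙xz (weight es x) (g t) _ ⟩
      g t + (weight es x + sum (map (weight es) xs))      ∎
      where open ≤-Reasoning

    sum-weight-≤ : ∀ es {xs} → Unique xs → sum (map (weight es) xs) ≤ sum (map (g ∘ proj₂) es)
    sum-weight-≤ []             {xs} _      = ≤-reflexive (sum-weight-[] xs)
    sum-weight-≤ ((a , t) ∷ es)      unique =
      ≤-trans (sum-weight-∷ unique) (+-monoʳ-≤ (g t) (sum-weight-≤ es unique))

  count≤paths : ∀ b k s → count b k s ≤ paths k s
  count≤paths b zero    s = ≤-refl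
  count≤paths b (suc k) s = begin
    count b (suc k) s
      ≡⟨ count-suc b k s ⟩
    sum (map (λ x → maybe (count b k) 0 (next s x)) (upTo b))
      ≤⟨ sum-weight-≤ (count b k) (edges s) (upTo⁺ b) ⟩
    sum (map (count b k ∘ proj₂) (edges s))
      ≤⟨ sum-map-mono (λ e → count≤paths b k (proj₂ e)) (edges s) ⟩
    paths (suc k) s ∎
    where open ≤-Reasoning

  count-mono-alphabet : ∀ {m b} → m ≤ b → ∀ k s → count m k s ≤ count b k s
  count-mono-alphabet m≤b zero    s = ≤-refl
  count-mono-alphabet {m} {b} m≤b (suc k) s = begin
    count m (suc k) s
      ≡⟨ count-suc m k s ⟩
    sum (map (λ x → maybe (count m k) 0 (next s x)) (upTo m))
      ≤⟨ sum-map-mono (λ x → count-mono-maybe (next s x)) (upTo m) ⟩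
    sum (map (λ x → maybe (count b k) 0 (next s x)) (upTo m))
      ≤⟨ sum-mono-⊆ (map⁺ _ (upTo-mono m≤b)) ⟩
    sum (map (λ x → maybe (count b k) 0 (next s x)) (upTo b))
      ≡⟨ count-suc b k s ⟨
    count b (suc k) s ∎
    where
    open ≤-Reasoning
    count-mono-maybe : ∀ r → maybe (count m k) 0 r ≤ maybe (count b k) 0 r
    count-mono-maybe nothing  = z≤n
    count-mono-maybe (just t) = count-mono-alphabet m≤b k t

-- Subwords and pattern containment

isRGS-from-∷⁺ : ∀ {m m′ x w} → x ≤ m → m ⊔ suc x ≡ m′ → T (isRGS-from m′ w) →
                T (isRGS-from m (x ∷ w))
isRGS-from-∷⁺ x≤m refl rgs = Equivalence.from T-∧ (≤⇒≤ᵇ x≤m , rgs)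

isRGS-from-∷⁻ : ∀ {m x w} → T (isRGS-from m (x ∷ w)) → x ≤ m × T (isRGS-from (m ⊔ suc x) w)
isRGS-from-∷⁻ {m} {x} rgs with x≤m , rgs′ ← Equivalence.to T-∧ rgs = ≤ᵇ⇒≤ x m x≤m , rgs′

words-complete : ∀ {b} {u : List ℕ} → All (_< b) u → u ∈ words (length u) b
words-complete                 []          = here refl
words-complete {b} {u = _ ∷ u} (x<b ∷ u<b) =
  ∈-concatMap⁺ (λ y → map (y ∷_) (words (length u) b))
               (lose (∈-upTo⁺ x<b) (∈-map⁺ (_ ∷_) (words-complete u<b)))

subwords-complete : ∀ {u π : List ℕ} → u ⊆ π → u ∈ subwords (length u) π
subwords-complete                 []         = here refl
subwords-complete {[]}            (_ ∷ʳ _)   = here refl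
subwords-complete {x ∷ u} {y ∷ π} (y ∷ʳ u⊆π) =
  ∈-++⁺ʳ (map (y ∷_) (subwords (length u) π)) (subwords-complete u⊆π)
subwords-complete                 (refl ∷ u⊆π) = ∈-++⁺ˡ (∈-map⁺ (_ ∷_) (subwords-complete u⊆π))

subwords-sound : ∀ k (π : List ℕ) {u} → u ∈ subwords k π → u ⊆ π × length u ≡ k
subwords-sound zero    π       (here refl) = minimum π , refl
subwords-sound (suc k) (x ∷ π) u∈ with ∈-++⁻ (map (x ∷_) (subwords k π)) u∈
... | inj₁ u∈map with _ , v∈ , refl ← ∈-map⁻ (x ∷_) u∈map
                 with v⊆π , |v|≡k ← subwords-sound k π v∈ = refl ∷ v⊆π , cong suc |v|≡k
... | inj₂ u∈rest with u⊆π , |u|≡k ← subwords-sound (suc k) π u∈rest = x ∷ʳ u⊆π , |u|≡k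

eqListᵇ-refl : ∀ xs → T (eqListᵇ xs xs)
eqListᵇ-refl []       = _
eqListᵇ-refl (x ∷ xs) = Equivalence.from T-∧ (≡⇒≡ᵇ x x refl , eqListᵇ-refl xs)

contains⁺ : ∀ {π u} τ → u ⊆ π → length u ≡ length τ → standardize u ≡ τ → T (contains π τ)
contains⁺ {π} {u} τ u⊆π |u|≡|τ| refl =
  any⁺ _ (lose (subst (λ k → u ∈ subwords k π) |u|≡|τ| (subwords-complete u⊆π)) (eqListᵇ-refl τ))

contains⁻ : ∀ π τ → T (contains π τ) →
            ∃ λ u → u ⊆ π × length u ≡ length τ × T (eqListᵇ (standardize u) τ)
contains⁻ π τ π∋τ with u , u∈ , u~τ ← find (any⁻ _ _ π∋τ)
                  with u⊆π , |u|≡|τ| ← subwords-sound (length τ) π u∈ = u , u⊆π , |u|≡|τ| , u~τ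

-- Avoiding 1/24/3

standardize-abcb : ∀ {a b c} → b ≢ a → c ≢ a → c ≢ b →
                   standardize (a ∷ b ∷ c ∷ b ∷ []) ≡ τ-1/24/3
standardize-abcb {a} {b} {c} b≢a c≢a c≢b
  -- each rewrite lets standardize unfold far enough to expose the next comparison
  rewrite ≢⇒≡ᵇ-false b≢a | ≢⇒≡ᵇ-false c≢a | ≢⇒≡ᵇ-false c≢b
        | ≡ᵇ-refl b | ≢⇒≡ᵇ-false b≢a | ≡ᵇ-refl b | ≢⇒≡ᵇ-false b≢a = refl

repeat⇒contains : ∀ {a b c p} xs → (a ∷ b ∷ c ∷ []) ⊆ p → b ≢ a → c ≢ a → c ≢ b →
                  T (contains (p ++ b ∷ xs) τ-1/24/3)
repeat⇒contains xs abc⊆p b≢a c≢a c≢b =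
  contains⁺ τ-1/24/3 (++⁺ abc⊆p (refl ∷ minimum xs)) refl (standardize-abcb b≢a c≢a c≢b)

data Stage : Set where
  initial zeros          : Stage
  rising returned sealed : ℕ → Stage

stageEdges : Stage → List (ℕ × Stage)
stageEdges initial      = (0 , zeros) ∷ []
stageEdges zeros        = (0 , zeros) ∷ (1 , rising 1) ∷ []
stageEdges (rising c)   = (c , rising c) ∷ (suc c , rising (suc c)) ∷ (0 , returned c) ∷ []
stageEdges (returned c) = (c , returned c) ∷ (suc c , sealed (suc c)) ∷ (0 , returned c) ∷ []
stageEdges (sealed c)   = (c , sealed c) ∷ (suc c , sealed (suc c)) ∷ []

module Stages = Automaton stageEdges

blocks : Stage → ℕ
blocks initial      = 0
blocks zeros        = 1
blocks (rising c)   = suc c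
blocks (returned c) = suc c
blocks (sealed c)   = suc c

RisingTo : ℕ → List ℕ → Set
RisingTo c p = c ≢ 0 × (0 ∷ c ∷ []) ⊆ p × (∀ {y} → y ≢ 0 → y < c → (0 ∷ y ∷ c ∷ []) ⊆ p)

Sealed : List ℕ → Set
Sealed p = ∃₂ λ u z → u ≢ 0 × z ≢ 0 × z ≢ u × (u ∷ 0 ∷ z ∷ []) ⊆ p

Invariant : Stage → List ℕ → Set
Invariant initial      p = ⊤
Invariant zeros        p = [ 0 ] ⊆ p
Invariant (rising c)   p = RisingTo c p
Invariant (returned c) p = RisingTo c p × (c ∷ 0 ∷ []) ⊆ p
Invariant (sealed c)   p = RisingTo c p × Sealed p

⊆-++ʳ : ∀ {u p : List ℕ} x → u ⊆ p → u ⊆ p ++ [ x ]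
⊆-++ʳ x = ++⁺ʳ [ x ]

RisingTo-++ : ∀ {c p} x → RisingTo c p → RisingTo c (p ++ [ x ])
RisingTo-++ x (c≢0 , 0c⊆p , 0yc⊆p) = c≢0 , ⊆-++ʳ x 0c⊆p , λ y≢0 y<c → ⊆-++ʳ x (0yc⊆p y≢0 y<c)

RisingTo-new : ∀ {c p} → RisingTo c p → RisingTo (suc c) (p ++ [ suc c ])
RisingTo-new {c} {p} (c≢0 , 0c⊆p , 0yc⊆p) =
  (λ ()) , ++⁺ (⊆-trans (refl ∷ c ∷ʳ []) 0c⊆p) ⊆-refl , 0y[1+c]
  where
  0y[1+c] : ∀ {y} → y ≢ 0 → y < suc c → (0 ∷ y ∷ suc c ∷ []) ⊆ p ++ [ suc c ]
  0y[1+c] y≢0 y<1+c with m≤n⇒m<n∨m≡n (s≤s⁻¹ y<1+c)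
  ... | inj₁ y<c  = ++⁺ (⊆-trans (refl ∷ refl ∷ c ∷ʳ []) (0yc⊆p y≢0 y<c)) ⊆-refl
  ... | inj₂ refl = ++⁺ 0c⊆p ⊆-refl

Sealed-++ : ∀ {p} x → Sealed p → Sealed (p ++ [ x ])
Sealed-++ x (u , z , u≢0 , z≢0 , z≢u , u0z⊆p) = u , z , u≢0 , z≢0 , z≢u , ⊆-++ʳ x u0z⊆p

invariant-step : ∀ {s t p x} → Invariant s p → (x , t) ∈ stageEdges s →
                 Invariant t (p ++ [ x ]) × blocks s ⊔ suc x ≡ blocks t
invariant-step {initial} {p = p} _ (here refl) = ++⁺ˡ p ⊆-refl , refl
invariant-step {zeros} 0⊆p (here refl)         = ⊆-++ʳ 0 0⊆p , refl
invariant-step {zeros} 0⊆p (there (here refl)) =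
  ((λ ()) , ++⁺ 0⊆p ⊆-refl , λ y≢0 y<1 → contradiction (n<1⇒n≡0 y<1) y≢0) , refl
invariant-step {rising c} inv (here refl)         = RisingTo-++ c inv , ⊔-idem (suc c)
invariant-step {rising c} inv (there (here refl)) = RisingTo-new inv , m≤n⇒m⊔n≡n (n≤1+n (suc c))
invariant-step {rising c} inv@(_ , 0c⊆p , _) (there (there (here refl))) =
  (RisingTo-++ 0 inv , ++⁺ (⊆-trans (0 ∷ʳ refl ∷ []) 0c⊆p) ⊆-refl) , cong suc (⊔-identityʳ c)
invariant-step {returned c} (inv , c0⊆p) (here refl) =
  (RisingTo-++ c inv , ⊆-++ʳ c c0⊆p) , ⊔-idem (suc c)
invariant-step {returned c} (inv@(c≢0 , _) , c0⊆p) (there (here refl)) =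
  (RisingTo-new inv , (c , suc c , c≢0 , (λ ()) , 1+n≢n , ++⁺ c0⊆p ⊆-refl)) ,
  m≤n⇒m⊔n≡n (n≤1+n (suc c))
invariant-step {returned c} (inv , c0⊆p) (there (there (here refl))) =
  (RisingTo-++ 0 inv , ⊆-++ʳ 0 c0⊆p) , cong suc (⊔-identityʳ c)
invariant-step {sealed c} (inv , seal) (here refl) =
  (RisingTo-++ c inv , Sealed-++ c seal) , ⊔-idem (suc c)
invariant-step {sealed c} (inv , seal) (there (here refl)) =
  (RisingTo-new inv , Sealed-++ (suc c) seal) , m≤n⇒m⊔n≡n (n≤1+n (suc c))

middle⇒contains : ∀ {c p x} xs → RisingTo c p → x ≢ 0 → x ≢ c → x ≢ suc c → x ≤ suc c →
                  T (contains (p ++ x ∷ xs) τ-1/24/3)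
middle⇒contains xs (c≢0 , _ , 0yc⊆p) x≢0 x≢c x≢1+c x≤1+c =
  repeat⇒contains xs (0yc⊆p x≢0 x<c) x≢0 c≢0 (≢-sym x≢c)
  where x<c = ≤∧≢⇒< (s≤s⁻¹ (≤∧≢⇒< x≤1+c x≢1+c)) x≢c

no-edge⇒contains : ∀ {s p x} xs → Invariant s p → x ≤ blocks s →
                   All ((x ≢_) ∘ proj₁) (stageEdges s) → T (contains (p ++ x ∷ xs) τ-1/24/3)
no-edge⇒contains {initial} xs _ z≤n       (x≢0 ∷ [])    = contradiction refl x≢0
no-edge⇒contains {zeros}   xs _ z≤n       (x≢0 ∷ _)     = contradiction refl x≢0
no-edge⇒contains {zeros}   xs _ (s≤s z≤n) (_ ∷ x≢1 ∷ _) = contradiction refl x≢1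
no-edge⇒contains {rising c} xs inv x≤ (x≢c ∷ x≢1+c ∷ x≢0 ∷ []) =
  middle⇒contains xs inv x≢0 x≢c x≢1+c x≤
no-edge⇒contains {returned c} xs (inv , _) x≤ (x≢c ∷ x≢1+c ∷ x≢0 ∷ []) =
  middle⇒contains xs inv x≢0 x≢c x≢1+c x≤
no-edge⇒contains {sealed c} {x = x} xs (inv , u , z , u≢0 , z≢0 , z≢u , u0z⊆p) x≤ (x≢c ∷ x≢1+c ∷ [])
  with x ≟ 0
... | yes refl = repeat⇒contains xs u0z⊆p (≢-sym u≢0) z≢u z≢0
... | no x≢0   = middle⇒contains xs inv x≢0 x≢c x≢1+c x≤

accepts-avoider : ∀ {s} p w → Invariant s p → T (isRGS-from (blocks s) w) →
                  T (avoids (p ++ w) τ-1/24/3) → T (Stages.accepts s w)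
accepts-avoider     p []      _   _   _ = tt
accepts-avoider {s} p (x ∷ w) inv rgs avoid
  with x≤ , rgs′ ← isRGS-from-∷⁻ {w = w} rgs
  with Stages.next s x in next≡
... | nothing =
  contradiction (no-edge⇒contains w inv x≤ (Stages.transition-nothing _ next≡)) (T-not⇒¬T avoid)
... | just t with inv′ , blocks≡ ← invariant-step inv (Stages.transition-just _ next≡) =
  accepts-avoider (p ++ [ x ]) w inv′ (subst (λ m → T (isRGS-from m w)) blocks≡ rgs′)
                  (subst (λ π → T (avoids π τ-1/24/3)) (sym (++-assoc p [ x ] w)) avoid)

-- Partitions with a bounded number of blocks

boundedEdges : ℕ → ℕ → List (ℕ × ℕ)
boundedEdges m j = map (_, j) (upTo j) ++ (if j <ᵇ m then [ (j , suc j) ] else [])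

module Bounded (m : ℕ) = Automaton (boundedEdges m)

boundedEdges-∈ : ∀ {m j x t} → (x , t) ∈ boundedEdges m j →
                 x < j × t ≡ j ⊎ x ≡ j × t ≡ suc j × j < m
boundedEdges-∈ {m} {j} e∈ with ∈-++⁻ (map (_, j) (upTo j)) e∈
... | inj₁ e∈old with x , x∈ , refl ← ∈-map⁻ (_, j) e∈old = inj₁ (∈-upTo⁻ x∈ , refl)
... | inj₂ e∈new with j <ᵇ m in j<ᵇm
...   | true  with here refl ← e∈new = inj₂ (refl , refl , <ᵇ⇒< j m (Equivalence.from T-≡ j<ᵇm))
...   | false with () ← e∈new

bounded-sound : ∀ {m j} w → j ≤ m → T (Bounded.accepts m j w) → T (isRGS-from j w) × All (_< m) w
bounded-sound         []      _   _   = _ , []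
bounded-sound {m} {j} (x ∷ w) j≤m acc with Bounded.next m j x in next≡
... | nothing with () ← acc
... | just t with boundedEdges-∈ {m} {j} (Bounded.transition-just m _ next≡)
...   | inj₁ (x<j , refl) with rgs , w<m ← bounded-sound w j≤m acc =
  isRGS-from-∷⁺ {w = w} (<⇒≤ x<j) (m≥n⇒m⊔n≡m x<j) rgs , <-≤-trans x<j j≤m ∷ w<m
...   | inj₂ (refl , refl , j<m) with rgs , w<m ← bounded-sound w j<m acc =
  isRGS-from-∷⁺ {w = w} ≤-refl (m≤n⇒m⊔n≡n (n≤1+n j)) rgs , j<m ∷ w<m

words-4-3-avoid-1/2/3/4 : All (λ u → ¬ T (eqListᵇ (standardize u) τ-1/2/3/4)) (words 4 3)
words-4-3-avoid-1/2/3/4 =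
  from-yes (All.all? (λ u → ¬? (T? (eqListᵇ (standardize u) τ-1/2/3/4))) (words 4 3))

avoids-1/2/3/4 : ∀ {w} → All (_< 3) w → T (avoids w τ-1/2/3/4)
avoids-1/2/3/4 {w} w<3 = ¬T⇒T-not λ w∋τ →
  let u , u⊆w , |u|≡4 , u~τ = contains⁻ w τ-1/2/3/4 w∋τ
  in All.lookup words-4-3-avoid-1/2/3/4
       (subst (λ k → u ∈ words k 3) |u|≡4 (words-complete (All-resp-⊆ u⊆w w<3))) u~τ

module Bounded₃ = Bounded 3

-- The edges of s correspond injectively to those of shadow s, with targets related by shadow.
shadow : Stage → ℕ
shadow initial      = 0
shadow zeros        = 1
shadow (rising _)   = 2
shadow (returned _) = 3
shadow (sealed _)   = 3

≤count-suc : ∀ {n} k j →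
             n ≤ sum (map (λ x → maybe (Bounded₃.count 3 k) 0 (Bounded₃.next j x)) (upTo 3)) →
             n ≤ Bounded₃.count 3 (suc k) j
≤count-suc k j n≤ = ≤-trans n≤ (≤-reflexive (sym (Bounded₃.count-suc 3 k j)))

paths≤count : ∀ k s → Stages.paths k s ≤ Bounded₃.count 3 k (shadow s)
paths≤count zero    s            = ≤-refl
paths≤count (suc k) initial      = ≤count-suc k 0 (+-mono-≤ (paths≤count k zeros) z≤n)
paths≤count (suc k) zeros        = ≤count-suc k 1
  (+-mono-≤ (paths≤count k zeros) (+-mono-≤ (paths≤count k (rising 1)) z≤n))
paths≤count (suc k) (rising c)   = ≤count-suc k 2
  (+-mono-≤ (paths≤count k (rising c))
  (+-mono-≤ (paths≤count k (rising (suc c))) (+-mono-≤ (paths≤count k (returned c)) z≤n)))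
paths≤count (suc k) (returned c) = ≤count-suc k 3
  (+-mono-≤ (paths≤count k (returned c))
  (+-mono-≤ (paths≤count k (sealed (suc c))) (+-mono-≤ (paths≤count k (returned c)) z≤n)))
paths≤count (suc k) (sealed c)   = ≤count-suc k 3
  (+-mono-≤ (paths≤count k (sealed c)) (+-mono-≤ (paths≤count k (sealed (suc c))) z≤n))

count-positive : ∀ k → 0 < Bounded₃.count 3 k 3
count-positive zero    = s≤s z≤n
count-positive (suc k) = ≤count-suc k 3 (≤-trans (count-positive k) (m≤m+n _ _))

paths<count-sealed : ∀ k c → Stages.paths (suc k) (sealed c) < Bounded₃.count 3 (suc k) 3
paths<count-sealed k c = ≤count-suc k 3
  (+-mono-≤-< (paths≤count k (sealed c))
  (+-mono-≤-< (paths≤count k (sealed (suc c))) (≤-trans (count-positive k) (m≤m+n _ 0))))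

paths<count-returned : ∀ k c → Stages.paths (2 + k) (returned c) < Bounded₃.count 3 (2 + k) 3
paths<count-returned k c = ≤count-suc (suc k) 3
  (+-mono-≤-< (paths≤count (suc k) (returned c))
  (+-mono-<-≤ (paths<count-sealed k (suc c)) (+-monoˡ-≤ 0 (paths≤count (suc k) (returned c)))))

paths<count-rising : ∀ k c → Stages.paths (3 + k) (rising c) < Bounded₃.count 3 (3 + k) 2
paths<count-rising k c = ≤count-suc (2 + k) 2
  (+-mono-≤-< (paths≤count (2 + k) (rising c))
  (+-mono-≤-< (paths≤count (2 + k) (rising (suc c))) (+-monoˡ-< 0 (paths<count-returned k c))))

paths<count-zeros : ∀ k → Stages.paths (4 + k) zeros < Bounded₃.count 3 (4 + k) 1
paths<count-zeros k = ≤count-suc (3 + k) 1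
  (+-mono-≤-< (paths≤count (3 + k) zeros) (+-monoˡ-< 0 (paths<count-rising k 1)))

paths<count-initial : ∀ k → Stages.paths (5 + k) initial < Bounded₃.count 3 (5 + k) 0
paths<count-initial k = ≤count-suc (4 + k) 0 (+-monoˡ-< 0 (paths<count-zeros k))

numAvoiders-≡ : ∀ n τ → numAvoiders n τ ≡ length (filterᵇ (λ π → isRGS π ∧ avoids π τ) (words n n))
numAvoiders-≡ n τ = cong length (filterᵇ-filterᵇ (λ π → avoids π τ) isRGS (words n n))

avoider⇒accepted : ∀ w → T (isRGS w ∧ avoids w τ-1/24/3) → T (Stages.accepts initial w)
avoider⇒accepted w rgs∧avoids with rgs , avoid ← Equivalence.to T-∧ rgs∧avoids =
  accepts-avoider [] w tt rgs avoid

accepted⇒avoider : ∀ w → T (Bounded₃.accepts 0 w) → T (isRGS w ∧ avoids w τ-1/2/3/4)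
accepted⇒avoider w acc with rgs , w<3 ← bounded-sound w z≤n acc =
  Equivalence.from T-∧ (rgs , avoids-1/2/3/4 w<3)

lemma4p5 : ∀ (n : ℕ) → 5 ≤ n → numAvoiders n τ-1/24/3 < numAvoiders n τ-1/2/3/4
lemma4p5 _ (s≤s (s≤s (s≤s (s≤s (s≤s {n = k} _))))) = begin-strict
  numAvoiders n τ-1/24/3
    ≡⟨ numAvoiders-≡ n τ-1/24/3 ⟩
  length (filterᵇ (λ π → isRGS π ∧ avoids π τ-1/24/3) (words n n))
    ≤⟨ length-filterᵇ-mono avoider⇒accepted (words n n) ⟩
  Stages.count n n initial
    ≤⟨ Stages.count≤paths n n initial ⟩
  Stages.paths n initial
    <⟨ paths<count-initial k ⟩
  Bounded₃.count 3 n 0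
    ≤⟨ Bounded₃.count-mono-alphabet (s≤s (s≤s (s≤s z≤n))) n 0 ⟩
  Bounded₃.count n n 0
    ≤⟨ length-filterᵇ-mono accepted⇒avoider (words n n) ⟩
  length (filterᵇ (λ π → isRGS π ∧ avoids π τ-1/2/3/4) (words n n))
    ≡⟨ numAvoiders-≡ n τ-1/2/3/4 ⟨
  numAvoiders n τ-1/2/3/4 ∎
  where
  open ≤-Reasoning
  n = 5 + k
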